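{- Let $\gamma\in\mathbb{N}_0$ and $\beta,\lambda\in\mathbb{N}$, and let $H_n(\lambda,\beta,\gamma)$ denote the coefficient of $\frac{x^n}{n!}$ in $\frac{e^{\gamma x}}{(2-e^{\beta x})^{\lambda}}$. Then for every $n\in\mathbb{N}_0$, $$\sum_{k=0}^{n}\sum_{s=0}^{k}\binom{k}{s}(-1)^{k-s}H_n(\lambda-1,\beta,\gamma+\beta s)=H_n(\lambda,\beta,\gamma).$$ -}

module Defs where

open import Data.Nat as ℕ using (ℕ; zero; suc; _≟_)
open import Data.Nat.Combinatorics using (_C_)
open import Data.Integer as ℤ using (ℤ; +_; -_; _+_; _*_; _^_)
open import Data.List using (List; map; foldr; upTo)
open import Relation.Nullary using (yes; no)

Σ≤ : ℕ → (ℕ → ℤ) → ℤ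
Σ≤ n f = foldr _+_ (+ 0) (map f (upTo (suc n)))

syntax Σ≤ n (λ k → e) = Σ[ k ≤ n ] e

-- A formal power series f(x) = Σ a_n x^n / n! is represented by its
-- exponential coefficients n ↦ a_n  (a_n = coefficient of x^n/n!).
-- All series occurring below have integer exponential coefficients.
EGF : Set
EGF = ℕ → ℤ

-- product of series  ↔  binomial convolution of exponential coefficients
_⊛_ : EGF → EGF → EGF
(a ⊛ b) n = Σ[ k ≤ n ] ((+ (n C k)) * (a k * b (ℕ._∸_ n k)))

one : EGF
one zero    = + 1
one (suc _) = + 0

_^ₛ_ : EGF → ℕ → EGF
a ^ₛ zero  = one
a ^ₛ suc m = a ⊛ (a ^ₛ m)

expS : ℕ → EGF
expS c n = + (c ℕ.^ n)

twoMinusExp : ℕ → EGF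
twoMinusExp β zero    = (+ 2) ℤ.- (+ 1)
twoMinusExp β (suc n) = - (+ (β ℕ.^ suc n))

-- Multiplicative inverse of a series a with a_0 = 1:
-- b_0 = 1,  b_n = - Σ_{k=1}^{n} C(n,k) a_k b_{n-k}   (n ≥ 1),
-- which is exactly the condition (a ⊛ b) = one.
-- invUpTo a n m = b_m for m ≤ n.
invUpTo : EGF → ℕ → EGF
invUpTo a zero m = one m
invUpTo a (suc n) m with m ≟ suc n
... | no _  = invUpTo a n m
... | yes _ = - (Σ[ k ≤ n ] ((+ (suc n C suc k)) * (a (suc k) * invUpTo a n (ℕ._∸_ n k))))

invS : EGF → EGF
invS a n = invUpTo a n n

H : ℕ → ℕ → ℕ → ℕ → ℤ
H n λ' β γ = (expS γ ⊛ (invS (twoMinusExp β) ^ₛ λ')) n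

-- For each k, Σ_s C(k,s) (−1)^(k−s) e^((γ+βs)x) = e^(γx) (e^(βx) − 1)^k, a series of
-- order k.  Hence, up to x^n, the sum over k ≤ n of these series is the geometric series
-- e^(γx) Σ_k (e^(βx) − 1)^k, which is e^(γx) / (2 − e^(βx)); convolving with
-- (2 − e^(βx))^−(λ−1) gives H(λ, β, γ).  The series identities needed (commutativity and
-- associativity of the binomial convolution, e^(cx) e^(dx) = e^((c+d)x)) all follow from
-- the Leibniz rule for the derivative ∂, which on exponential coefficients is a shift.
module Submission where

open import Defs
open import Data.Nat as ℕ using (ℕ; zero; suc; _≤_; _<_; _∸_; z≤n; s≤s; _≟_)
import Data.Nat.Properties as ℕₚ
open import Data.Nat.Combinatorics using (_C_; nCk+nC[k+1]≡[n+1]C[k+1]; k>n⇒nCk≡0)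
open import Data.Integer as ℤ using (ℤ; +_; -_; _+_; _-_; _*_; _^_)
import Data.Integer.Properties as ℤₚ
open import Data.Integer.Tactic.RingSolver using (solve-∀)
open import Data.List using (map; foldr; applyUpTo)
open import Data.Sum using (inj₁; inj₂)
open import Data.Empty using (⊥-elim)
open import Relation.Nullary using (yes; no)
open import Relation.Binary.PropositionalEquality
  using (_≡_; refl; sym; trans; cong; cong₂; module ≡-Reasoning)

open ≡-Reasoning

∑ : ℕ → (ℕ → ℤ) → ℤ
∑ zero    f = + 0
∑ (suc n) f = f 0 + ∑ n (λ k → f (suc k))

foldr-map-applyUpTo : ∀ n (f : ℕ → ℤ) (g : ℕ → ℕ) →
  foldr _+_ (+ 0) (map f (applyUpTo g n)) ≡ ∑ n (λ k → f (g k))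
foldr-map-applyUpTo zero    f g = refl
foldr-map-applyUpTo (suc n) f g = cong (_+_ (f (g 0))) (foldr-map-applyUpTo n f (λ k → g (suc k)))

Σ≤≡∑ : ∀ n (f : ℕ → ℤ) → Σ≤ n f ≡ ∑ (suc n) f
Σ≤≡∑ n f = foldr-map-applyUpTo (suc n) f (λ k → k)

∑-cong : ∀ n {f g : ℕ → ℤ} → (∀ k → k < n → f k ≡ g k) → ∑ n f ≡ ∑ n g
∑-cong zero    eq = refl
∑-cong (suc n) eq = cong₂ _+_ (eq 0 (s≤s z≤n)) (∑-cong n (λ k k<n → eq (suc k) (s≤s k<n)))

∑-zero : ∀ n {f : ℕ → ℤ} → (∀ k → k < n → f k ≡ + 0) → ∑ n f ≡ + 0
∑-zero zero    eq = refl
∑-zero (suc n) eq = cong₂ _+_ (eq 0 (s≤s z≤n)) (∑-zero n (λ k k<n → eq (suc k) (s≤s k<n)))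

∑-distrib-+ : ∀ n (f g : ℕ → ℤ) → ∑ n (λ k → f k + g k) ≡ ∑ n f + ∑ n g
∑-distrib-+ zero    f g = refl
∑-distrib-+ (suc n) f g =
  trans (cong (_+_ (f 0 + g 0)) (∑-distrib-+ n _ _)) (interchange (f 0) (g 0) _ _)
  where
  interchange : ∀ a b c d → (a + b) + (c + d) ≡ (a + c) + (b + d)
  interchange = solve-∀

∑-*ˡ : ∀ n c (f : ℕ → ℤ) → ∑ n (λ k → c * f k) ≡ c * ∑ n f
∑-*ˡ zero    c f = sym (ℤₚ.*-zeroʳ c)
∑-*ˡ (suc n) c f = trans (cong (_+_ (c * f 0)) (∑-*ˡ n c _)) (sym (ℤₚ.*-distribˡ-+ c (f 0) _))

∑-last : ∀ n (f : ℕ → ℤ) → ∑ (suc n) f ≡ ∑ n f + f n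
∑-last zero    f = ℤₚ.+-comm (f 0) (+ 0)
∑-last (suc n) f = trans (cong (_+_ (f 0)) (∑-last n _)) (sym (ℤₚ.+-assoc (f 0) _ _))

∑-telescope : ∀ n (g : ℕ → ℤ) → ∑ n (λ k → g k - g (suc k)) ≡ g 0 - g n
∑-telescope zero    g = sym (ℤₚ.+-inverseʳ (g 0))
∑-telescope (suc n) g = trans (cong (_+_ (g 0 - g 1)) (∑-telescope n (λ k → g (suc k))))
                              (ℤₚ.+-minus-telescope (g 0) (g 1) (g (suc n)))

∑-pascal : ∀ n (t : ℕ → ℤ) →
  ∑ (suc n) (λ k → + (suc n C suc k) * t k)
    ≡ ∑ (suc n) (λ k → + (n C k) * t k) + ∑ n (λ k → + (n C suc k) * t k)
∑-pascal n t = begin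
    ∑ (suc n) (λ k → + (suc n C suc k) * t k)
  ≡⟨ ∑-cong (suc n) (λ k _ → pascal k) ⟩
    ∑ (suc n) (λ k → lower k + upper k)
  ≡⟨ ∑-distrib-+ (suc n) lower upper ⟩
    ∑ (suc n) lower + ∑ (suc n) upper
  ≡⟨ cong (_+_ (∑ (suc n) lower)) (∑-last n upper) ⟩
    ∑ (suc n) lower + (∑ n upper + upper n)
  ≡⟨ cong (λ x → ∑ (suc n) lower + (∑ n upper + x)) upper-n≡0 ⟩
    ∑ (suc n) lower + (∑ n upper + + 0)
  ≡⟨ cong (_+_ (∑ (suc n) lower)) (ℤₚ.+-identityʳ (∑ n upper)) ⟩
    ∑ (suc n) lower + ∑ n upper
  ∎
  where
  lower upper : ℕ → ℤ
  lower k = + (n C k) * t k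
  upper k = + (n C suc k) * t k
  pascal : ∀ k → + (suc n C suc k) * t k ≡ lower k + upper k
  pascal k = begin
    + (suc n C suc k) * t k              ≡⟨ cong (λ c → + c * t k) (nCk+nC[k+1]≡[n+1]C[k+1] n k) ⟨
    + (n C k ℕ.+ n C suc k) * t k        ≡⟨ cong (_* t k) (ℤₚ.pos-+ (n C k) (n C suc k)) ⟩
    (+ (n C k) + + (n C suc k)) * t k    ≡⟨ ℤₚ.*-distribʳ-+ (t k) (+ (n C k)) (+ (n C suc k)) ⟩
    lower k + upper k                    ∎
  upper-n≡0 : upper n ≡ + 0
  upper-n≡0 = cong (λ c → + c * t n) (k>n⇒nCk≡0 (ℕₚ.n<1+n n))

⊛-expand : ∀ (a b : EGF) n → (a ⊛ b) n ≡ ∑ (suc n) (λ k → + (n C k) * (a k * b (n ∸ k)))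
⊛-expand a b n = Σ≤≡∑ n (λ k → + (n C k) * (a k * b (n ∸ k)))

⊛-head : ∀ (a b : EGF) n →
  (a ⊛ b) n ≡ a 0 * b n + ∑ n (λ k → + (n C suc k) * (a (suc k) * b (n ∸ suc k)))
⊛-head a b n = trans (⊛-expand a b n) (cong (_+ ∑ n tail) (ℤₚ.*-identityˡ (a 0 * b n)))
  where
  tail : ℕ → ℤ
  tail k = + (n C suc k) * (a (suc k) * b (n ∸ suc k))

⊛-cong : ∀ n {a a′ b b′ : EGF} →
  (∀ m → m ≤ n → a m ≡ a′ m) → (∀ m → m ≤ n → b m ≡ b′ m) → (a ⊛ b) n ≡ (a′ ⊛ b′) n
⊛-cong n {a} {a′} {b} {b′} a≡a′ b≡b′ =
  trans (⊛-expand a b n) (trans (∑-cong (suc n) term≡) (sym (⊛-expand a′ b′ n)))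
  where
  term≡ : ∀ k → k < suc n → + (n C k) * (a k * b (n ∸ k)) ≡ + (n C k) * (a′ k * b′ (n ∸ k))
  term≡ k k<1+n = cong (+ (n C k) *_)
    (cong₂ _*_ (a≡a′ k (ℕₚ.m<1+n⇒m≤n k<1+n)) (b≡b′ (n ∸ k) (ℕₚ.m∸n≤m n k)))

⊛-congˡ : ∀ {a a′ : EGF} (b : EGF) n →
  (∀ m → m ≤ n → a m ≡ a′ m) → (a ⊛ b) n ≡ (a′ ⊛ b) n
⊛-congˡ {a} {a′} b n a≡a′ = ⊛-cong n {a} {a′} {b} {b} a≡a′ (λ _ _ → refl)

⊛-congʳ : ∀ (a : EGF) {b b′ : EGF} n →
  (∀ m → m ≤ n → b m ≡ b′ m) → (a ⊛ b) n ≡ (a ⊛ b′) n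
⊛-congʳ a {b} {b′} n b≡b′ = ⊛-cong n {a} {a} {b} {b′} (λ _ _ → refl) b≡b′

⊛-at-order : ∀ (a b : EGF) m → (∀ j → j < m → b j ≡ + 0) → (a ⊛ b) m ≡ a 0 * b m
⊛-at-order a b m b≡0 = trans (⊛-head a b m)
  (trans (cong (_+_ (a 0 * b m)) (∑-zero m term≡0)) (ℤₚ.+-identityʳ (a 0 * b m)))
  where
  term≡0 : ∀ k → k < m → + (m C suc k) * (a (suc k) * b (m ∸ suc k)) ≡ + 0
  term≡0 k k<m = begin
    + (m C suc k) * (a (suc k) * b (m ∸ suc k))
      ≡⟨ cong (λ x → + (m C suc k) * (a (suc k) * x)) (b≡0 (m ∸ suc k) m∸[1+k]<m) ⟩
    + (m C suc k) * (a (suc k) * + 0)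
      ≡⟨ cong (+ (m C suc k) *_) (ℤₚ.*-zeroʳ (a (suc k))) ⟩
    + (m C suc k) * + 0
      ≡⟨ ℤₚ.*-zeroʳ (+ (m C suc k)) ⟩
    + 0 ∎
    where
    m∸[1+k]<m : m ∸ suc k < m
    m∸[1+k]<m = ℕₚ.∸-monoʳ-< (s≤s z≤n) k<m

∂ : EGF → EGF
∂ a m = a (suc m)

⊛-leibniz : ∀ (a b : EGF) n → (a ⊛ b) (suc n) ≡ (∂ a ⊛ b) n + (a ⊛ ∂ b) n
⊛-leibniz a b n = begin
    (a ⊛ b) (suc n)
  ≡⟨ ⊛-head a b (suc n) ⟩
    h + ∑ (suc n) (λ k → + (suc n C suc k) * t k)
  ≡⟨ cong (_+_ h) (∑-pascal n t) ⟩
    h + (∑ (suc n) (λ k → + (n C k) * t k) + ∑ n (λ k → + (n C suc k) * t k))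
  ≡⟨ swap h (∑ (suc n) (λ k → + (n C k) * t k)) (∑ n (λ k → + (n C suc k) * t k)) ⟩
    ∑ (suc n) (λ k → + (n C k) * t k) + (h + ∑ n (λ k → + (n C suc k) * t k))
  ≡⟨ cong₂ _+_ (sym (⊛-expand (∂ a) b n))
               (trans (cong (_+_ h) (∑-cong n reindex)) (sym (⊛-head a (∂ b) n))) ⟩
    (∂ a ⊛ b) n + (a ⊛ ∂ b) n
  ∎
  where
  h : ℤ
  h = a 0 * b (suc n)
  t : ℕ → ℤ
  t k = a (suc k) * b (n ∸ k)
  swap : ∀ x y z → x + (y + z) ≡ y + (x + z)
  swap = solve-∀
  reindex : ∀ k → k < n → + (n C suc k) * t k ≡ + (n C suc k) * (a (suc k) * ∂ b (n ∸ suc k))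
  reindex k k<n = cong (λ i → + (n C suc k) * (a (suc k) * b i)) (ℕₚ.+-∸-assoc 1 k<n)

⊛-comm : ∀ (a b : EGF) n → (a ⊛ b) n ≡ (b ⊛ a) n
⊛-comm a b zero    = cong (λ x → + 1 * x + + 0) (ℤₚ.*-comm (a 0) (b 0))
⊛-comm a b (suc n) = begin
    (a ⊛ b) (suc n)             ≡⟨ ⊛-leibniz a b n ⟩
    (∂ a ⊛ b) n + (a ⊛ ∂ b) n   ≡⟨ cong₂ _+_ (⊛-comm (∂ a) b n) (⊛-comm a (∂ b) n) ⟩
    (b ⊛ ∂ a) n + (∂ b ⊛ a) n   ≡⟨ ℤₚ.+-comm ((b ⊛ ∂ a) n) ((∂ b ⊛ a) n) ⟩
    (∂ b ⊛ a) n + (b ⊛ ∂ a) n   ≡⟨ ⊛-leibniz b a n ⟨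
    (b ⊛ a) (suc n)             ∎

⊛-identityˡ : ∀ (a : EGF) n → (one ⊛ a) n ≡ a n
⊛-identityˡ a n = trans (⊛-head one a n)
  (trans (cong₂ _+_ (ℤₚ.*-identityˡ (a n)) (∑-zero n (λ k _ → ℤₚ.*-zeroʳ (+ (n C suc k)))))
         (ℤₚ.+-identityʳ (a n)))

⊛-distribʳ-+ : ∀ (a a′ b : EGF) n → ((λ m → a m + a′ m) ⊛ b) n ≡ (a ⊛ b) n + (a′ ⊛ b) n
⊛-distribʳ-+ a a′ b n = begin
    ((λ m → a m + a′ m) ⊛ b) n
  ≡⟨ ⊛-expand (λ m → a m + a′ m) b n ⟩
    ∑ (suc n) (λ k → + (n C k) * ((a k + a′ k) * b (n ∸ k)))
  ≡⟨ ∑-cong (suc n) (λ k _ → distrib (+ (n C k)) (a k) (a′ k) (b (n ∸ k))) ⟩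
    ∑ (suc n) (λ k → term a k + term a′ k)
  ≡⟨ ∑-distrib-+ (suc n) (term a) (term a′) ⟩
    ∑ (suc n) (term a) + ∑ (suc n) (term a′)
  ≡⟨ cong₂ _+_ (⊛-expand a b n) (⊛-expand a′ b n) ⟨
    (a ⊛ b) n + (a′ ⊛ b) n
  ∎
  where
  term : EGF → ℕ → ℤ
  term x k = + (n C k) * (x k * b (n ∸ k))
  distrib : ∀ c x y z → c * ((x + y) * z) ≡ c * (x * z) + c * (y * z)
  distrib = solve-∀

⊛-scaleˡ : ∀ c (a b : EGF) n → ((λ m → c * a m) ⊛ b) n ≡ c * (a ⊛ b) n
⊛-scaleˡ c a b n = begin
    ((λ m → c * a m) ⊛ b) n
  ≡⟨ ⊛-expand (λ m → c * a m) b n ⟩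
    ∑ (suc n) (λ k → + (n C k) * ((c * a k) * b (n ∸ k)))
  ≡⟨ ∑-cong (suc n) (λ k _ → pull (+ (n C k)) c (a k) (b (n ∸ k))) ⟩
    ∑ (suc n) (λ k → c * term k)
  ≡⟨ ∑-*ˡ (suc n) c term ⟩
    c * ∑ (suc n) term
  ≡⟨ cong (c *_) (⊛-expand a b n) ⟨
    c * (a ⊛ b) n
  ∎
  where
  term : ℕ → ℤ
  term k = + (n C k) * (a k * b (n ∸ k))
  pull : ∀ d c x z → d * ((c * x) * z) ≡ c * (d * (x * z))
  pull = solve-∀

⊛-zeroˡ : ∀ (b : EGF) n → ((λ _ → + 0) ⊛ b) n ≡ + 0
⊛-zeroˡ b n = trans (⊛-expand (λ _ → + 0) b n) (∑-zero (suc n) (λ k _ → ℤₚ.*-zeroʳ (+ (n C k))))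

⊛-distribʳ-∑ : ∀ N (F : ℕ → EGF) (b : EGF) n →
  ((λ m → ∑ N (λ i → F i m)) ⊛ b) n ≡ ∑ N (λ i → (F i ⊛ b) n)
⊛-distribʳ-∑ zero    F b n = ⊛-zeroˡ b n
⊛-distribʳ-∑ (suc N) F b n = trans (⊛-distribʳ-+ (F 0) _ b n)
  (cong (_+_ ((F 0 ⊛ b) n)) (⊛-distribʳ-∑ N (λ i → F (suc i)) b n))

⊛-distribˡ-+ : ∀ (a b b′ : EGF) n → (a ⊛ (λ m → b m + b′ m)) n ≡ (a ⊛ b) n + (a ⊛ b′) n
⊛-distribˡ-+ a b b′ n = trans (⊛-comm a (λ m → b m + b′ m) n)
  (trans (⊛-distribʳ-+ b b′ a n) (cong₂ _+_ (⊛-comm b a n) (⊛-comm b′ a n)))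

⊛-scaleʳ : ∀ c (a b : EGF) n → (a ⊛ (λ m → c * b m)) n ≡ c * (a ⊛ b) n
⊛-scaleʳ c a b n = trans (⊛-comm a (λ m → c * b m) n)
  (trans (⊛-scaleˡ c b a n) (cong (c *_) (⊛-comm b a n)))

⊛-distribˡ-∑ : ∀ N (a : EGF) (F : ℕ → EGF) n →
  (a ⊛ (λ m → ∑ N (λ i → F i m))) n ≡ ∑ N (λ i → (a ⊛ F i) n)
⊛-distribˡ-∑ N a F n = trans (⊛-comm a (λ m → ∑ N (λ i → F i m)) n)
  (trans (⊛-distribʳ-∑ N F a n) (∑-cong N (λ i _ → ⊛-comm (F i) a n)))

⊛-assoc : ∀ (a b c : EGF) n → ((a ⊛ b) ⊛ c) n ≡ (a ⊛ (b ⊛ c)) n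
⊛-assoc a b c zero    = constantTerm (a 0) (b 0) (c 0)
  where
  constantTerm : ∀ x y z →
    + 1 * ((+ 1 * (x * y) + + 0) * z) + + 0 ≡ + 1 * (x * (+ 1 * (y * z) + + 0)) + + 0
  constantTerm = solve-∀
⊛-assoc a b c (suc n) = begin
    ((a ⊛ b) ⊛ c) (suc n)
  ≡⟨ ⊛-leibniz (a ⊛ b) c n ⟩
    (∂ (a ⊛ b) ⊛ c) n + ((a ⊛ b) ⊛ ∂ c) n
  ≡⟨ cong (_+ ((a ⊛ b) ⊛ ∂ c) n) (trans (⊛-congˡ {∂ (a ⊛ b)} c n (λ m _ → ⊛-leibniz a b m))
                                        (⊛-distribʳ-+ (∂ a ⊛ b) (a ⊛ ∂ b) c n)) ⟩
    (((∂ a ⊛ b) ⊛ c) n + ((a ⊛ ∂ b) ⊛ c) n) + ((a ⊛ b) ⊛ ∂ c) n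
  ≡⟨ cong₂ _+_ (cong₂ _+_ (⊛-assoc (∂ a) b c n) (⊛-assoc a (∂ b) c n)) (⊛-assoc a b (∂ c) n) ⟩
    ((∂ a ⊛ (b ⊛ c)) n + (a ⊛ (∂ b ⊛ c)) n) + (a ⊛ (b ⊛ ∂ c)) n
  ≡⟨ ℤₚ.+-assoc ((∂ a ⊛ (b ⊛ c)) n) ((a ⊛ (∂ b ⊛ c)) n) ((a ⊛ (b ⊛ ∂ c)) n) ⟩
    (∂ a ⊛ (b ⊛ c)) n + ((a ⊛ (∂ b ⊛ c)) n + (a ⊛ (b ⊛ ∂ c)) n)
  ≡⟨ cong (_+_ ((∂ a ⊛ (b ⊛ c)) n)) (trans (⊛-congʳ a {∂ (b ⊛ c)} n (λ m _ → ⊛-leibniz b c m))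
                                            (⊛-distribˡ-+ a (∂ b ⊛ c) (b ⊛ ∂ c) n)) ⟨
    (∂ a ⊛ (b ⊛ c)) n + (a ⊛ ∂ (b ⊛ c)) n
  ≡⟨ ⊛-leibniz a (b ⊛ c) n ⟨
    (a ⊛ (b ⊛ c)) (suc n)
  ∎

∂-expS : ∀ c m → ∂ (expS c) m ≡ + c * expS c m
∂-expS c m = ℤₚ.pos-* c (c ℕ.^ m)

⊛-expS : ∀ c d n → (expS c ⊛ expS d) n ≡ expS (c ℕ.+ d) n
⊛-expS c d zero    = refl
⊛-expS c d (suc n) = begin
    (expS c ⊛ expS d) (suc n)
  ≡⟨ ⊛-leibniz (expS c) (expS d) n ⟩
    (∂ (expS c) ⊛ expS d) n + (expS c ⊛ ∂ (expS d)) n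
  ≡⟨ cong₂ _+_ (trans (⊛-congˡ {∂ (expS c)} (expS d) n (λ m _ → ∂-expS c m))
                      (⊛-scaleˡ (+ c) (expS c) (expS d) n))
               (trans (⊛-congʳ (expS c) {∂ (expS d)} n (λ m _ → ∂-expS d m))
                      (⊛-scaleʳ (+ d) (expS c) (expS d) n)) ⟩
    + c * (expS c ⊛ expS d) n + + d * (expS c ⊛ expS d) n
  ≡⟨ ℤₚ.*-distribʳ-+ _ (+ c) (+ d) ⟨
    (+ c + + d) * (expS c ⊛ expS d) n
  ≡⟨ cong₂ _*_ (sym (ℤₚ.pos-+ c d)) (⊛-expS c d n) ⟩
    + (c ℕ.+ d) * expS (c ℕ.+ d) n
  ≡⟨ ∂-expS (c ℕ.+ d) n ⟨
    expS (c ℕ.+ d) (suc n)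
  ∎

invUpTo-suc : ∀ (a : EGF) n m → m ≤ n → invUpTo a (suc n) m ≡ invUpTo a n m
invUpTo-suc a n m m≤n with m ≟ suc n
... | no _     = refl
... | yes refl = ⊥-elim (ℕₚ.1+n≰n m≤n)

invUpTo-stable : ∀ (a : EGF) n m → m ≤ n → invUpTo a n m ≡ invS a m
invUpTo-stable a zero    zero z≤n = refl
invUpTo-stable a (suc n) m m≤1+n with ℕₚ.m≤n⇒m<n∨m≡n m≤1+n
... | inj₁ (s≤s m≤n) = trans (invUpTo-suc a n m m≤n) (invUpTo-stable a n m m≤n)
... | inj₂ refl      = refl

invS-suc : ∀ (a : EGF) n →
  invS a (suc n) ≡ - ∑ (suc n) (λ k → + (suc n C suc k) * (a (suc k) * invS a (n ∸ k)))
invS-suc a n with suc n ≟ suc n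
... | no n≢n = ⊥-elim (n≢n refl)
... | yes _  = cong -_ (trans (Σ≤≡∑ n (term (invUpTo a n))) (∑-cong (suc n) (λ k _ →
  cong (λ x → + (suc n C suc k) * (a (suc k) * x)) (invUpTo-stable a n (n ∸ k) (ℕₚ.m∸n≤m n k)))))
  where
  term : EGF → ℕ → ℤ
  term b k = + (suc n C suc k) * (a (suc k) * b (n ∸ k))

⊛-inverseʳ : ∀ (a : EGF) → a 0 ≡ + 1 → ∀ n → (a ⊛ invS a) n ≡ one n
⊛-inverseʳ a a₀≡1 zero    rewrite a₀≡1 = refl
⊛-inverseʳ a a₀≡1 (suc n) = begin
    (a ⊛ invS a) (suc n)
  ≡⟨ ⊛-head a (invS a) (suc n) ⟩
    a 0 * invS a (suc n) + R
  ≡⟨ cong₂ (λ x y → x * y + R) a₀≡1 (invS-suc a n) ⟩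
    + 1 * - R + R
  ≡⟨ cong (_+ R) (ℤₚ.*-identityˡ (- R)) ⟩
    - R + R
  ≡⟨ ℤₚ.+-inverseˡ R ⟩
    + 0
  ∎
  where
  R : ℤ
  R = ∑ (suc n) (λ k → + (suc n C suc k) * (a (suc k) * invS a (n ∸ k)))

⊛-inverseˡ : ∀ (a : EGF) → a 0 ≡ + 1 → ∀ n → (invS a ⊛ a) n ≡ one n
⊛-inverseˡ a a₀≡1 n = trans (⊛-comm (invS a) a n) (⊛-inverseʳ a a₀≡1 n)

Δ : ℕ → (ℕ → ℤ) → ℤ
Δ k f = ∑ (suc k) (λ s → + (k C s) * ((- (+ 1)) ^ (k ∸ s) * f s))

Δ-cong : ∀ k {f g : ℕ → ℤ} → (∀ s → f s ≡ g s) → Δ k f ≡ Δ k g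
Δ-cong k f≡g = ∑-cong (suc k) (λ s _ →
  cong (λ x → + (k C s) * ((- (+ 1)) ^ (k ∸ s) * x)) (f≡g s))

Δ-suc : ∀ k (f : ℕ → ℤ) → Δ (suc k) f ≡ Δ k (λ s → f (suc s)) - Δ k f
Δ-suc k f = begin
    Δ (suc k) f
  ≡⟨ cong (_+_ h) (∑-pascal k u) ⟩
    h + (Δ k (λ s → f (suc s)) + ∑ k (λ s → + (k C suc s) * u s))
  ≡⟨ cong (λ r → h + (Δ k (λ s → f (suc s)) + r)) (trans (∑-cong k signFlip) (∑-*ˡ k (- (+ 1)) term)) ⟩
    h + (Δ k (λ s → f (suc s)) + - (+ 1) * R)
  ≡⟨ rearrange ((- (+ 1)) ^ k) (f 0) (Δ k (λ s → f (suc s))) R ⟩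
    Δ k (λ s → f (suc s)) - Δ k f
  ∎
  where
  h : ℤ
  h = + 1 * ((- (+ 1)) ^ suc k * f 0)
  u : ℕ → ℤ
  u s = (- (+ 1)) ^ (k ∸ s) * f (suc s)
  term : ℕ → ℤ
  term s = + (k C suc s) * ((- (+ 1)) ^ (k ∸ suc s) * f (suc s))
  R : ℤ
  R = ∑ k term
  signFlip : ∀ s → s < k → + (k C suc s) * u s ≡ - (+ 1) * term s
  signFlip s s<k =
    trans (cong (λ e → + (k C suc s) * ((- (+ 1)) ^ e * f (suc s))) (ℕₚ.+-∸-assoc 1 s<k))
          (pull (+ (k C suc s)) ((- (+ 1)) ^ (k ∸ suc s)) (f (suc s)))
    where
    pull : ∀ c p x → c * ((- (+ 1) * p) * x) ≡ - (+ 1) * (c * (p * x))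
    pull = solve-∀
  rearrange : ∀ p x d r → + 1 * ((- (+ 1) * p) * x) + (d + - (+ 1) * r) ≡ d - (+ 1 * (p * x) + r)
  rearrange = solve-∀

⊛-Δˡ : ∀ k (F : ℕ → EGF) (b : EGF) n →
  ((λ m → Δ k (λ s → F s m)) ⊛ b) n ≡ Δ k (λ s → (F s ⊛ b) n)
⊛-Δˡ k F b n = trans (⊛-distribʳ-∑ (suc k) (λ s m → + (k C s) * (sign s * F s m)) b n)
  (∑-cong (suc k) (λ s _ → trans (⊛-scaleˡ (+ (k C s)) (λ m → sign s * F s m) b n)
                                 (cong (+ (k C s) *_) (⊛-scaleˡ (sign s) (F s) b n))))
  where
  sign : ℕ → ℤ
  sign s = (- (+ 1)) ^ (k ∸ s)

⊛-Δʳ : ∀ k (a : EGF) (F : ℕ → EGF) n →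
  (a ⊛ (λ m → Δ k (λ s → F s m))) n ≡ Δ k (λ s → (a ⊛ F s) n)
⊛-Δʳ k a F n = trans (⊛-comm a (λ m → Δ k (λ s → F s m)) n)
  (trans (⊛-Δˡ k F a n) (Δ-cong k (λ s → ⊛-comm (F s) a n)))

-- expDiffPow β γ k is e^(γx) (e^(βx) − 1)^k, expanded by the binomial theorem.
expDiffPow : ℕ → ℕ → ℕ → EGF
expDiffPow β γ k m = Δ k (λ s → expS (γ ℕ.+ β ℕ.* s) m)

expDiffPow-zero : ∀ β γ m → expDiffPow β γ 0 m ≡ expS γ m
expDiffPow-zero β γ m = begin
    + 1 * (+ 1 * expS (γ ℕ.+ β ℕ.* 0) m) + + 0
  ≡⟨ trans (ℤₚ.+-identityʳ _) (trans (ℤₚ.*-identityˡ _) (ℤₚ.*-identityˡ _)) ⟩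
    expS (γ ℕ.+ β ℕ.* 0) m
  ≡⟨ cong (λ e → expS e m) (trans (cong (γ ℕ.+_) (ℕₚ.*-zeroʳ β)) (ℕₚ.+-identityʳ γ)) ⟩
    expS γ m
  ∎

expDiffPow-suc : ∀ β γ k m →
  expDiffPow β γ (suc k) m ≡ (expS β ⊛ expDiffPow β γ k) m - expDiffPow β γ k m
expDiffPow-suc β γ k m =
  trans (Δ-suc k (λ s → expS (γ ℕ.+ β ℕ.* s) m)) (cong (_- expDiffPow β γ k m) (begin
    Δ k (λ s → expS (γ ℕ.+ β ℕ.* suc s) m)
  ≡⟨ Δ-cong k (λ s → trans (cong (λ e → expS e m) (exponent s)) (sym (⊛-expS β _ m))) ⟩
    Δ k (λ s → (expS β ⊛ expS (γ ℕ.+ β ℕ.* s)) m)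
  ≡⟨ ⊛-Δʳ k (expS β) (λ s → expS (γ ℕ.+ β ℕ.* s)) m ⟨
    (expS β ⊛ expDiffPow β γ k) m
  ∎))
  where
  exponent : ∀ s → γ ℕ.+ β ℕ.* suc s ≡ β ℕ.+ (γ ℕ.+ β ℕ.* s)
  exponent s = begin
    γ ℕ.+ β ℕ.* suc s        ≡⟨ cong (γ ℕ.+_) (ℕₚ.*-suc β s) ⟩
    γ ℕ.+ (β ℕ.+ β ℕ.* s)    ≡⟨ ℕₚ.+-assoc γ β _ ⟨
    γ ℕ.+ β ℕ.+ β ℕ.* s      ≡⟨ cong (ℕ._+ β ℕ.* s) (ℕₚ.+-comm γ β) ⟩
    β ℕ.+ γ ℕ.+ β ℕ.* s      ≡⟨ ℕₚ.+-assoc β γ _ ⟩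
    β ℕ.+ (γ ℕ.+ β ℕ.* s)    ∎

expDiffPow-vanishes : ∀ β γ k m → m < k → expDiffPow β γ k m ≡ + 0
expDiffPow-vanishes β γ (suc k) m (s≤s m≤k) = begin
    expDiffPow β γ (suc k) m
  ≡⟨ expDiffPow-suc β γ k m ⟩
    (expS β ⊛ expDiffPow β γ k) m - expDiffPow β γ k m
  ≡⟨ cong (_- expDiffPow β γ k m) (⊛-at-order (expS β) _ m (λ j j<m →
       expDiffPow-vanishes β γ k j (ℕₚ.<-≤-trans j<m m≤k))) ⟩
    + 1 * expDiffPow β γ k m - expDiffPow β γ k m
  ≡⟨ cong (_- expDiffPow β γ k m) (ℤₚ.*-identityˡ (expDiffPow β γ k m)) ⟩
    expDiffPow β γ k m - expDiffPow β γ k m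
  ≡⟨ ℤₚ.+-inverseʳ (expDiffPow β γ k m) ⟩
    + 0
  ∎

twoMinusExp-split : ∀ β j → twoMinusExp β j ≡ + 2 * one j + - (+ 1) * expS β j
twoMinusExp-split β zero    = refl
twoMinusExp-split β (suc j) = negation (expS β (suc j))
  where
  negation : ∀ x → - x ≡ + 2 * + 0 + - (+ 1) * x
  negation = solve-∀

twoMinusExp-⊛-expDiffPow : ∀ β γ k m →
  (twoMinusExp β ⊛ expDiffPow β γ k) m ≡ expDiffPow β γ k m - expDiffPow β γ (suc k) m
twoMinusExp-⊛-expDiffPow β γ k m = begin
    (twoMinusExp β ⊛ G) m
  ≡⟨ ⊛-congˡ {twoMinusExp β} G m (λ j _ → twoMinusExp-split β j) ⟩
    ((λ j → + 2 * one j + - (+ 1) * expS β j) ⊛ G) m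
  ≡⟨ ⊛-distribʳ-+ (λ j → + 2 * one j) (λ j → - (+ 1) * expS β j) G m ⟩
    ((λ j → + 2 * one j) ⊛ G) m + ((λ j → - (+ 1) * expS β j) ⊛ G) m
  ≡⟨ cong₂ _+_ (trans (⊛-scaleˡ (+ 2) one G m) (cong (+ 2 *_) (⊛-identityˡ G m)))
               (⊛-scaleˡ (- (+ 1)) (expS β) G m) ⟩
    + 2 * G m + - (+ 1) * (expS β ⊛ G) m
  ≡⟨ regroup (G m) ((expS β ⊛ G) m) ⟩
    G m - ((expS β ⊛ G) m - G m)
  ≡⟨ cong (_-_ (G m)) (expDiffPow-suc β γ k m) ⟨
    G m - expDiffPow β γ (suc k) m
  ∎
  where
  G : EGF
  G = expDiffPow β γ k
  regroup : ∀ g e → + 2 * g + - (+ 1) * e ≡ g - (e - g)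
  regroup = solve-∀

geometricSum : ℕ → ℕ → ℕ → EGF
geometricSum β γ n m = ∑ (suc n) (λ k → expDiffPow β γ k m)

twoMinusExp-⊛-geometricSum : ∀ β γ n m → m ≤ n →
  (twoMinusExp β ⊛ geometricSum β γ n) m ≡ expS γ m
twoMinusExp-⊛-geometricSum β γ n m m≤n = begin
    (twoMinusExp β ⊛ geometricSum β γ n) m
  ≡⟨ ⊛-distribˡ-∑ (suc n) (twoMinusExp β) (expDiffPow β γ) m ⟩
    ∑ (suc n) (λ k → (twoMinusExp β ⊛ expDiffPow β γ k) m)
  ≡⟨ ∑-cong (suc n) (λ k _ → twoMinusExp-⊛-expDiffPow β γ k m) ⟩
    ∑ (suc n) (λ k → expDiffPow β γ k m - expDiffPow β γ (suc k) m)
  ≡⟨ ∑-telescope (suc n) (λ k → expDiffPow β γ k m) ⟩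
    expDiffPow β γ 0 m - expDiffPow β γ (suc n) m
  ≡⟨ cong₂ _-_ (expDiffPow-zero β γ m) (expDiffPow-vanishes β γ (suc n) m (s≤s m≤n)) ⟩
    expS γ m - + 0
  ≡⟨ ℤₚ.+-identityʳ (expS γ m) ⟩
    expS γ m
  ∎

geometricSum≡expS⊛invS : ∀ β γ n m → m ≤ n →
  geometricSum β γ n m ≡ (expS γ ⊛ invS (twoMinusExp β)) m
geometricSum≡expS⊛invS β γ n m m≤n = begin
    Q m
  ≡⟨ ⊛-identityˡ Q m ⟨
    (one ⊛ Q) m
  ≡⟨ ⊛-congˡ {one} Q m (λ j _ → sym (⊛-inverseˡ T refl j)) ⟩
    ((invS T ⊛ T) ⊛ Q) m
  ≡⟨ ⊛-assoc (invS T) T Q m ⟩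
    (invS T ⊛ (T ⊛ Q)) m
  ≡⟨ ⊛-congʳ (invS T) {T ⊛ Q} m (λ j j≤m →
       twoMinusExp-⊛-geometricSum β γ n j (ℕₚ.≤-trans j≤m m≤n)) ⟩
    (invS T ⊛ expS γ) m
  ≡⟨ ⊛-comm (invS T) (expS γ) m ⟩
    (expS γ ⊛ invS T) m
  ∎
  where
  T : EGF
  T = twoMinusExp β
  Q : EGF
  Q = geometricSum β γ n

∑Δ[expS⊛P]≡[expS⊛invS]⊛P : ∀ γ β (P : EGF) n →
  (Σ[ k ≤ n ] (Σ[ s ≤ k ] ((+ (k C s)) * (((- (+ 1)) ^ (k ∸ s)) * (expS (γ ℕ.+ β ℕ.* s) ⊛ P) n))))
    ≡ ((expS γ ⊛ invS (twoMinusExp β)) ⊛ P) n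
∑Δ[expS⊛P]≡[expS⊛invS]⊛P γ β P n = begin
    Σ≤ n (λ k → Σ≤ k (term k))
  ≡⟨ Σ≤≡∑ n (λ k → Σ≤ k (term k)) ⟩
    ∑ (suc n) (λ k → Σ≤ k (term k))
  ≡⟨ ∑-cong (suc n) (λ k _ → trans (Σ≤≡∑ k (term k)) (sym (⊛-Δˡ k expShift P n))) ⟩
    ∑ (suc n) (λ k → (expDiffPow β γ k ⊛ P) n)
  ≡⟨ ⊛-distribʳ-∑ (suc n) (expDiffPow β γ) P n ⟨
    (geometricSum β γ n ⊛ P) n
  ≡⟨ ⊛-congˡ {geometricSum β γ n} P n (geometricSum≡expS⊛invS β γ n) ⟩
    ((expS γ ⊛ invS (twoMinusExp β)) ⊛ P) n
  ∎
  where
  expShift : ℕ → EGF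
  expShift s = expS (γ ℕ.+ β ℕ.* s)
  term : ℕ → ℕ → ℤ
  term k s = + (k C s) * ((- (+ 1)) ^ (k ∸ s) * (expShift s ⊛ P) n)

corollary2 : (γ β λ' : ℕ) → 1 ≤ β → 1 ≤ λ' → (n : ℕ) →
    (Σ[ k ≤ n ] (Σ[ s ≤ k ] ((+ (k C s)) * (((- (+ 1)) ^ (k ∸ s)) * H n (λ' ∸ 1) β (γ ℕ.+ β ℕ.* s)))))
      ≡ H n λ' β γ
corollary2 γ β zero    _ () n
corollary2 γ β (suc l) _ _  n = trans (∑Δ[expS⊛P]≡[expS⊛invS]⊛P γ β (I ^ₛ l) n) (⊛-assoc (expS γ) I (I ^ₛ l) n)
  where
  I : EGF
  I = invS (twoMinusExp β)
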